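{- Let $G=(V,E)$ be an $s$-connector and let $\mathcal{G}$ be a fully-coloured acyclic $q$-colouring of $G$. Let $K$ be an edge of $\mathcal{C}(\mathcal{G})$ of maximum size. Then $|V\setminus K|\le 13(s-1)$.
   Context: A graph $G=(V,E)$ is an $s$-connector if $E$ contains an edge between $X$ and $Y$ for every pair of disjoint $X,Y\subseteq V$ with $|X|,|Y|\ge s$. A $q$-colouring of $G$ is a sequence $\mathcal{G}=(G_0,G_1,\dots,G_q)$ of simple graphs $G_j=(V,E_j)$ with $\bigcup_{j=0}^qE_j=E$; it is fully-coloured if $E_0=\varnothing$. $\mathcal{C}(\mathcal{G})$ is the multi-hypergraph on $V$ whose edges are the vertex sets of all connected components of $G_1,\dots,G_q$. A hypergraph is a hyperforest if its vertex–edge incidence bipartite graph (joining $u$ to $S$ iff $u\in S$) has no cycles; $\mathcal{G}$ is acyclic if $\mathcal{C}(\mathcal{G})$ is a hyperforest. -}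

module Defs where

open import Data.Nat using (ℕ; suc; _≥_; _≤_; _*_; _∸_)
open import Data.Fin using (Fin; zero; suc; inject₁; fromℕ)
open import Data.Fin.Subset using (Subset; _∈_; _∉_; ∣_∣; ∁)
open import Data.Product using (Σ; ∃; _×_; _,_)
open import Data.Sum using (_⊎_)
open import Data.Empty using (⊥)
open import Relation.Nullary using (¬_)
open import Relation.Binary.PropositionalEquality using (_≡_; _≢_)
open import Function.Bundles using (_⇔_)

record SimpleGraph (n : ℕ) : Set₁ where
  field
    Adj     : Fin n → Fin n → Set
    sym     : ∀ {u v} → Adj u v → Adj v u
    irrefl  : ∀ {u} → ¬ Adj u u
open SimpleGraph public

Disjoint : ∀ {n} → Subset n → Subset n → Set
Disjoint X Y = ∀ v → v ∈ X → v ∉ Y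

IsConnector : ∀ {n} → ℕ → SimpleGraph n → Set
IsConnector {n} s G =
  (X Y : Subset n) → Disjoint X Y → ∣ X ∣ ≥ s → ∣ Y ∣ ≥ s →
  Σ (Fin n) λ x → Σ (Fin n) λ y → x ∈ X × y ∈ Y × Adj G x y

-- A q-colouring (G_0, G_1, ..., G_q) of G; index zero is G_0.
Colouring : ℕ → ℕ → Set₁
Colouring n q = Fin (suc q) → SimpleGraph n

IsColouringOf : ∀ {n q} → Colouring n q → SimpleGraph n → Set
IsColouringOf {n} {q} 𝒢 G =
  ∀ (u v : Fin n) → Adj G u v ⇔ (Σ (Fin (suc q)) λ j → Adj (𝒢 j) u v)

FullyColoured : ∀ {n q} → Colouring n q → Set
FullyColoured 𝒢 = ∀ u v → ¬ Adj (𝒢 zero) u v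

data Reach {n} (H : SimpleGraph n) : Fin n → Fin n → Set where
  here : ∀ {u} → Reach H u u
  step : ∀ {u v w} → Adj H u v → Reach H v w → Reach H u w

-- Colour j ∈ {1,…,q} is represented by c : Fin q, graph G_{suc c}.
Col : ∀ {n q} → Colouring n q → Fin q → SimpleGraph n
Col 𝒢 c = 𝒢 (suc c)

-- An edge of the multi-hypergraph C(𝒢) is a connected component of some
-- G_c (c ∈ {1..q}); it is named by a pair (c , r) with r a vertex of it.
SameHyperedge : ∀ {n q} → Colouring n q → Fin q → Fin n → Fin q → Fin n → Set
SameHyperedge 𝒢 c r c' r' = Σ (c ≡ c') λ _ → Reach (Col 𝒢 c) r r'

InHyperedge : ∀ {n q} → Colouring n q → Fin n → Fin q → Fin n → Set
InHyperedge 𝒢 u c r = Reach (Col 𝒢 c) r u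

-- A cycle in the vertex–hyperedge incidence bipartite graph of C(𝒢):
--   u_0 S_0 u_1 S_1 … u_{k-1} S_{k-1} u_k = u_0 ,
-- with k ≥ 2, the u_0..u_{k-1} pairwise distinct, the hyperedges
-- S_0..S_{k-1} pairwise distinct, and u_i , u_{i+1} ∈ S_i.
record IncidenceCycle {n q} (𝒢 : Colouring n q) : Set where
  field
    k      : ℕ
    k≥2    : k ≥ 2
    u      : Fin (suc k) → Fin n
    closed : u (fromℕ k) ≡ u zero
    u-inj  : ∀ i j → u (inject₁ i) ≡ u (inject₁ j) → i ≡ j
    col    : Fin k → Fin q
    rep    : Fin k → Fin n
    S-inj  : ∀ i j → SameHyperedge 𝒢 (col i) (rep i) (col j) (rep j) → i ≡ j
    inS    : ∀ i → InHyperedge 𝒢 (u (inject₁ i)) (col i) (rep i)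
    inS'   : ∀ i → InHyperedge 𝒢 (u (suc i)) (col i) (rep i)

Acyclic : ∀ {n q} → Colouring n q → Set
Acyclic 𝒢 = ¬ IncidenceCycle 𝒢

IsComponent : ∀ {n q} → Colouring n q → Fin q → Fin n → Subset n → Set
IsComponent {n} 𝒢 c r K = ∀ (w : Fin n) → (w ∈ K) ⇔ Reach (Col 𝒢 c) r w

IsMaxEdge : ∀ {n q} → Colouring n q → Subset n → Set
IsMaxEdge {n} {q} 𝒢 K =
  (Σ (Fin q) λ c → Σ (Fin n) λ r → IsComponent 𝒢 c r K) ×
  (∀ (c : Fin q) (r : Fin n) (K' : Subset n) → IsComponent 𝒢 c r K' → ∣ K' ∣ ≤ ∣ K ∣)

module Submission where

open import Defs
open import Data.Nat using (ℕ; _≤_; _*_; _∸_)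
open import Data.Fin.Subset using (Subset; ∣_∣; ∁)

open import Data.Nat.Base using (zero; suc; _+_; _<_; z≤n; s≤s)
open import Data.Nat.Properties
  using (≤-refl; ≤-trans; <⇒≤; <⇒≱; ≮⇒≥; ≤-<-trans; <-≤-trans; _≤?_; m≤m+n; n≤1+n;
         m≤n⇒m≤1+n; ≤-pred; +-mono-≤; +-monoʳ-≤; +-suc; +-assoc; +-identityʳ; ∸-monoʳ-≤;
         *-monoˡ-≤)
open import Data.Nat.Induction using (<-wellFounded)
open import Induction.WellFounded using (Acc; acc)
open import Data.Fin.Base using (Fin; zero; suc; toℕ; inject₁; fromℕ)
open import Data.Fin.Properties
  using (<-cmp; toℕ<n; toℕ≤pred[n]; toℕ-fromℕ; toℕ-inject₁; inject₁-injective;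
         fromℕ≢inject₁)
open import Data.Fin.Subset
  using (_∈_; _∉_; _⊆_; _⊂_; _∪_; _∩_; ⊤; inside; outside) renaming (⊥ to ∅)
open import Data.Fin.Subset.Properties
  using (_∈?_; ∉⊥; ∣⊥∣≡0; ∣p∣≤n; ∣⊤∣≡n; ∣∁p∣≡n∸∣p∣; p⊆q⇒∣p∣≤∣q∣; p⊂q⇒∣p∣<∣q∣; p⊆p∪q;
         x∈p∪q⁺; x∈p∪q⁻; x∈p∩q⁺; x∈p∩q⁻; x∈∁p⇒x∉p; x∉p⇒x∈∁p)
open import Data.Vec.Base using ([]; _∷_; here; there)
open import Data.Empty using (⊥)
open import Data.Product using (Σ-syntax; _×_; _,_; proj₁; proj₂)
open import Data.Sum using (_⊎_; inj₁; inj₂)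
open import Function using (_∘_)
open import Function.Bundles using (Equivalence; mk⇔)
open import Level using (0ℓ)
open import Relation.Binary.Definitions using (tri<; tri≈; tri>)
open import Relation.Binary.Construct.Closure.ReflexiveTransitive
  using (Star; ε; _◅_; _◅◅_)
import Relation.Binary.Construct.Closure.ReflexiveTransitive as Star
open import Relation.Binary.PropositionalEquality as ≡
  using (_≡_; _≢_; refl; cong; subst; subst₂)
open import Relation.Nullary using (¬_; Dec; yes; no; does; contradiction)
open import Relation.Nullary.Decidable using (¬¬-excluded-middle; decidable-stable)
open import Relation.Unary using (Pred; Decidable)

-- The argument gives |V ∖ K| ≤ 3(s − 1). Write s = s′ + 1 and call w trapped in W if
-- it lies in a set of at most s′ vertices with no edge to the rest of W. In an
-- s-connector no set W of more than 3s′ vertices consists of trapped vertices: uniting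
-- trapping sets one at a time yields a set X with s′ < |X| ≤ 2s′ and no edge to W ∖ X,
-- which has more than s′ vertices.
--
-- Suppose |V ∖ K| > 3s′, so that, K being maximal, more than 3s′ vertices lie outside
-- every hyperedge S. For A ⊆ S let X be the set of vertices reachable from S ∖ A by hops
-- within hyperedges that never visit A; we show |X| ≤ s′ by induction on |X|. If
-- |X| > s′, every vertex w outside S is trapped in V ∖ S, a contradiction: if w ∉ X, by
-- V ∖ (S ∪ X); if w ∈ X, let x be the last vertex of S on its path and E the hyperedge
-- through which it leaves S, and take the vertices reachable from E avoiding x. By
-- acyclicity no path from E ∖ {x} avoiding x returns to S, so this set lies in X ∖ {x}
-- and the induction hypothesis makes it small. Finally, with A = ∅ and S a hyperedge
-- through w, this traps every vertex w in V, a contradiction.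

reach-trans : ∀ {n} {H : SimpleGraph n} {u v w} → Reach H u v → Reach H v w → Reach H u w
reach-trans here       q = q
reach-trans (step e p) q = step e (reach-trans p q)

reach-sym : ∀ {n} {H : SimpleGraph n} {u v} → Reach H u v → Reach H v u
reach-sym         here       = here
reach-sym {H = H} (step e p) = reach-trans (reach-sym p) (step (SimpleGraph.sym H e) here)

-- Adjacency is an arbitrary Set, so reachability is not decidable; as every goal below
-- is ⊥ or a decidable inequality, decidability of predicates on Fin n may be assumed.
¬¬-decidable : ∀ {n} (P : Pred (Fin n) 0ℓ) → ¬ ¬ Decidable P
¬¬-decidable {zero}  P k = k (λ ())
¬¬-decidable {suc n} P k =
  ¬¬-excluded-middle λ P₀? → ¬¬-decidable (P ∘ suc) λ P₊? →
  k λ { zero → P₀? ; (suc i) → P₊? i }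

toSubset : ∀ {n} {P : Pred (Fin n) 0ℓ} → Decidable P → Subset n
toSubset {zero}  P? = []
toSubset {suc n} P? = does (P? zero) ∷ toSubset (P? ∘ suc)

∈-toSubset⁺ : ∀ {n} {P : Pred (Fin n) 0ℓ} (P? : Decidable P) {v} → P v → v ∈ toSubset P?
∈-toSubset⁺ P? {zero} p with P? zero
... | yes _ = here
... | no ¬p = contradiction p ¬p
∈-toSubset⁺ P? {suc v} p = there (∈-toSubset⁺ (P? ∘ suc) p)

∈-toSubset⁻ : ∀ {n} {P : Pred (Fin n) 0ℓ} (P? : Decidable P) {v} → v ∈ toSubset P? → P v
∈-toSubset⁻ P? {zero} v∈ with P? zero | v∈
... | yes p | _ = p
∈-toSubset⁻ P? {suc v} (there v∈) = ∈-toSubset⁻ (P? ∘ suc) v∈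

∣p∪q∣≤∣p∣+∣q∣ : ∀ {n} (p q : Subset n) → ∣ p ∪ q ∣ ≤ ∣ p ∣ + ∣ q ∣
∣p∪q∣≤∣p∣+∣q∣ []            []            = z≤n
∣p∪q∣≤∣p∣+∣q∣ (inside ∷ p)  (inside ∷ q)  =
  s≤s (≤-trans (∣p∪q∣≤∣p∣+∣q∣ p q) (+-monoʳ-≤ ∣ p ∣ (n≤1+n ∣ q ∣)))
∣p∪q∣≤∣p∣+∣q∣ (inside ∷ p)  (outside ∷ q) = s≤s (∣p∪q∣≤∣p∣+∣q∣ p q)
∣p∪q∣≤∣p∣+∣q∣ (outside ∷ p) (inside ∷ q)  =
  subst (suc ∣ p ∪ q ∣ ≤_) (≡.sym (+-suc ∣ p ∣ ∣ q ∣)) (s≤s (∣p∪q∣≤∣p∣+∣q∣ p q))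
∣p∪q∣≤∣p∣+∣q∣ (outside ∷ p) (outside ∷ q) = ∣p∪q∣≤∣p∣+∣q∣ p q

∣p∣≤∣q∣+∣p∩∁q∣ : ∀ {n} (p q : Subset n) → ∣ p ∣ ≤ ∣ q ∣ + ∣ p ∩ ∁ q ∣
∣p∣≤∣q∣+∣p∩∁q∣ p q = ≤-trans (p⊆q⇒∣p∣≤∣q∣ p⊆q∪[p∩∁q]) (∣p∪q∣≤∣p∣+∣q∣ q (p ∩ ∁ q))
  where
  p⊆q∪[p∩∁q] : p ⊆ q ∪ (p ∩ ∁ q)
  p⊆q∪[p∩∁q] {x} x∈p with x ∈? q
  ... | yes x∈q = x∈p∪q⁺ (inj₁ x∈q)
  ... | no  x∉q = x∈p∪q⁺ (inj₂ (x∈p∩q⁺ (x∈p , x∉p⇒x∈∁p x∉q)))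

∣p∣≤∣q∣⇒∣∁q∣≤∣∁p∣ : ∀ {n} (p q : Subset n) → ∣ p ∣ ≤ ∣ q ∣ → ∣ ∁ q ∣ ≤ ∣ ∁ p ∣
∣p∣≤∣q∣⇒∣∁q∣≤∣∁p∣ {n} p q ∣p∣≤∣q∣ =
  subst₂ _≤_ (≡.sym (∣∁p∣≡n∸∣p∣ q)) (≡.sym (∣∁p∣≡n∸∣p∣ p)) (∸-monoʳ-≤ n ∣p∣≤∣q∣)

symmetric-<-free⇒≡ : ∀ {m} {R : Fin m → Fin m → Set} →
                     (∀ {i j} → R i j → R j i) → (∀ {i j} → toℕ i < toℕ j → ¬ R i j) →
                     ∀ {i j} → R i j → i ≡ j
symmetric-<-free⇒≡ R-sym <-free {i} {j} r with <-cmp i j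
... | tri< i<j _   _   = contradiction r (<-free i<j)
... | tri≈ _   i≡j _   = i≡j
... | tri> _   _   j<i = contradiction (R-sym r) (<-free j<i)

¬connector-0 : ∀ {n} (G : SimpleGraph n) → ¬ IsConnector 0 G
¬connector-0 G conn with conn ∅ ∅ (λ _ v∈∅ _ → ∉⊥ v∈∅) z≤n z≤n
... | _ , _ , x∈∅ , _ = ∉⊥ x∈∅

module Connector {n} (G : SimpleGraph n) (s′ : ℕ) (conn : IsConnector (suc s′) G) where

  ClosedIn : Subset n → Subset n → Set
  ClosedIn W X = ∀ {a b} → a ∈ X → b ∈ W → Adj G a b → b ∈ X

  Trapped : Subset n → Fin n → Set
  Trapped W w = Σ[ P ∈ Subset n ] w ∈ P × ∣ P ∣ ≤ s′ × ClosedIn W P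

  ∪-closedIn : ∀ {W X Y} → ClosedIn W X → ClosedIn W Y → ClosedIn W (X ∪ Y)
  ∪-closedIn {X = X} {Y} X-closed Y-closed a∈X∪Y b∈W e with x∈p∪q⁻ X Y a∈X∪Y
  ... | inj₁ a∈X = x∈p∪q⁺ (inj₁ (X-closed a∈X b∈W e))
  ... | inj₂ a∈Y = x∈p∪q⁺ (inj₂ (Y-closed a∈Y b∈W e))

  closedIn-large⇒rest-small : ∀ {W X} → ClosedIn W X → s′ < ∣ X ∣ → ∣ W ∩ ∁ X ∣ ≤ s′
  closedIn-large⇒rest-small {W} {X} X-closed X-large = ≮⇒≥ λ rest-large →
    let (x , y , x∈X , y∈rest , e) = conn X (W ∩ ∁ X) disjoint X-large rest-large
        (y∈W , y∈∁X)                = x∈p∩q⁻ W (∁ X) y∈rest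
    in  x∈∁p⇒x∉p y∈∁X (X-closed x∈X y∈W e)
    where
    disjoint : Disjoint X (W ∩ ∁ X)
    disjoint v v∈X v∈rest = x∈∁p⇒x∉p (proj₂ (x∈p∩q⁻ W (∁ X) v∈rest)) v∈X

  closedIn-large⇒rest-trapped : ∀ {W X w} → ClosedIn W X → s′ < ∣ X ∣ →
                                w ∈ W → w ∉ X → Trapped W w
  closedIn-large⇒rest-trapped {W} {X} X-closed X-large w∈W w∉X =
      W ∩ ∁ X
    , x∈p∩q⁺ (w∈W , x∉p⇒x∈∁p w∉X)
    , closedIn-large⇒rest-small X-closed X-large
    , rest-closed
    where
    rest-closed : ClosedIn W (W ∩ ∁ X)
    rest-closed a∈rest b∈W e =
      let (a∈W , a∈∁X) = x∈p∩q⁻ W (∁ X) a∈rest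
      in  x∈p∩q⁺ (b∈W , x∉p⇒x∈∁p λ b∈X →
                         x∈∁p⇒x∉p a∈∁X (X-closed b∈X a∈W (SimpleGraph.sym G e)))

  module _ {W : Subset n} (trapped : ∀ {w} → w ∈ W → ¬ ¬ Trapped W w) (s′<∣W∣ : s′ < ∣ W ∣)
    where

    enlarge : ∀ {X} → ClosedIn W X → ∣ X ∣ ≤ s′ →
              ¬ ¬ (Σ[ X′ ∈ Subset n ] ClosedIn W X′ × ∣ X ∣ < ∣ X′ ∣ × ∣ X′ ∣ ≤ s′ + s′)
    enlarge {X} X-closed X-small k =
      point-outside λ (w , w∈W , w∉X) → trapped w∈W λ (P , w∈P , P-small , P-closed) →
      k ( X ∪ P
        , ∪-closedIn X-closed P-closed
        , p⊂q⇒∣p∣<∣q∣ (p⊆p∪q {p = X} P , w , x∈p∪q⁺ (inj₂ w∈P) , w∉X)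
        , ≤-trans (∣p∪q∣≤∣p∣+∣q∣ X P) (+-mono-≤ X-small P-small))
      where
      point-outside : ¬ ¬ (Σ[ w ∈ Fin n ] w ∈ W × w ∉ X)
      point-outside none = <⇒≱ (≤-<-trans X-small s′<∣W∣) (p⊆q⇒∣p∣≤∣q∣ W⊆X)
        where
        W⊆X : W ⊆ X
        W⊆X {w} w∈W = decidable-stable (w ∈? X) λ w∉X → none (w , w∈W , w∉X)

    grow : ∀ t → t ≤ suc s′ →
           ¬ ¬ (Σ[ X ∈ Subset n ] ClosedIn W X × t ≤ ∣ X ∣ × ∣ X ∣ ≤ s′ + s′)
    grow zero _ k =
      k (∅ , (λ a∈∅ → contradiction a∈∅ ∉⊥) , z≤n , subst (_≤ s′ + s′) (≡.sym (∣⊥∣≡0 n)) z≤n)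
    grow (suc t) t<1+s′ k =
      grow t (≤-trans (n≤1+n t) t<1+s′) λ (X , X-closed , t≤∣X∣ , X-small) →
      extend X X-closed t≤∣X∣ X-small (suc t ≤? ∣ X ∣)
      where
      extend : ∀ X → ClosedIn W X → t ≤ ∣ X ∣ → ∣ X ∣ ≤ s′ + s′ → Dec (suc t ≤ ∣ X ∣) → ⊥
      extend X X-closed _ X-small (yes t<∣X∣) = k (X , X-closed , t<∣X∣ , X-small)
      extend X X-closed t≤∣X∣ _ (no t≮∣X∣) =
        enlarge X-closed (≤-trans (≮⇒≥ t≮∣X∣) (≤-pred t<1+s′))
          λ (X′ , X′-closed , ∣X∣<∣X′∣ , X′-small) →
        k (X′ , X′-closed , ≤-<-trans t≤∣X∣ ∣X∣<∣X′∣ , X′-small)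

  ¬-everywhere-trapped : ∀ {W} → s′ + s′ + s′ < ∣ W ∣ → ¬ (∀ {w} → w ∈ W → ¬ ¬ Trapped W w)
  ¬-everywhere-trapped {W} W-large trapped =
    grow trapped s′<∣W∣ (suc s′) ≤-refl λ (X , X-closed , X-large , X-small) →
    <⇒≱ W-large (≤-trans (∣p∣≤∣q∣+∣p∩∁q∣ W X)
                         (+-mono-≤ X-small (closedIn-large⇒rest-small X-closed X-large)))
    where
    s′<∣W∣ : s′ < ∣ W ∣
    s′<∣W∣ = ≤-<-trans (≤-trans (m≤m+n s′ s′) (m≤m+n (s′ + s′) s′)) W-large

module Incidence {n q} (𝒢 : Colouring n q) where

  Hyperedge : Set
  Hyperedge = Fin q × Fin n

  _∈ₕ_ : Fin n → Hyperedge → Set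
  u ∈ₕ E = InHyperedge 𝒢 u (proj₁ E) (proj₂ E)

  _≈ₕ_ : Hyperedge → Hyperedge → Set
  E ≈ₕ F = SameHyperedge 𝒢 (proj₁ E) (proj₂ E) (proj₁ F) (proj₂ F)

  ≈ₕ-sym : ∀ {E F} → E ≈ₕ F → F ≈ₕ E
  ≈ₕ-sym (refl , r) = refl , reach-sym r

  ∈ₕ-resp-≈ₕ : ∀ {E F u} → E ≈ₕ F → u ∈ₕ F → u ∈ₕ E
  ∈ₕ-resp-≈ₕ (refl , r) u∈F = reach-trans r u∈F

  Step : (Hyperedge → Set) → Fin n → Hyperedge → Fin n → Set
  Step P u E v = u ∈ₕ E × v ∈ₕ E × P E

  data Walk (P : Hyperedge → Set) : Fin n → Fin n → Set where
    []  : ∀ {x} → Walk P x x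
    _∷_ : ∀ {x E y z} → Step P x E y → Walk P y z → Walk P x z

  module _ {P : Hyperedge → Set} where

    length : ∀ {x z} → Walk P x z → ℕ
    length []      = 0
    length (_ ∷ w) = suc (length w)

    -- Past the end of the walk, vertexAt returns its last vertex.
    vertexAt : ∀ {x z} → Walk P x z → ℕ → Fin n
    vertexAt {x} _       zero    = x
    vertexAt {x} []      (suc i) = x
    vertexAt     (_ ∷ w) (suc i) = vertexAt w i

    edgeAt : ∀ {x z} (w : Walk P x z) → Fin (length w) → Hyperedge
    edgeAt (_∷_ {E = E} _ _) zero    = E
    edgeAt (_ ∷ w)           (suc i) = edgeAt w i

    step-at : ∀ {x z} (w : Walk P x z) (i : Fin (length w)) →
              Step P (vertexAt w (toℕ i)) (edgeAt w i) (vertexAt w (suc (toℕ i)))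
    step-at (s ∷ _) zero    = s
    step-at (_ ∷ w) (suc i) = step-at w i

    vertexAt-length : ∀ {x z} (w : Walk P x z) → vertexAt w (length w) ≡ z
    vertexAt-length []      = refl
    vertexAt-length (_ ∷ w) = vertexAt-length w

    x≢z⇒length>0 : ∀ {x z} → x ≢ z → (w : Walk P x z) → 0 < length w
    x≢z⇒length>0 x≢z []      = contradiction refl x≢z
    x≢z⇒length>0 _   (_ ∷ _) = s≤s z≤n

    drop : ∀ {x z} (j : ℕ) (w : Walk P x z) → Walk P (vertexAt w j) z
    drop zero    w       = w
    drop (suc j) []      = []
    drop (suc j) (_ ∷ w) = drop j w

    length-drop-≤ : ∀ {x z} j (w : Walk P x z) → length (drop j w) ≤ length w
    length-drop-≤ zero    w       = ≤-refl
    length-drop-≤ (suc j) []      = z≤n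
    length-drop-≤ (suc j) (_ ∷ w) = m≤n⇒m≤1+n (length-drop-≤ j w)

    shortcut : ∀ {x z E i j} (w : Walk P x z) → i ≤ j →
               Step P (vertexAt w i) E (vertexAt w j) → Walk P x z
    shortcut {j = j} w       z≤n       s = s ∷ drop j w
    shortcut         []      (s≤s _)   _ = []
    shortcut         (t ∷ w) (s≤s i≤j) s = t ∷ shortcut w i≤j s

    shortcut-shorter : ∀ {x z E i j} (w : Walk P x z) (i≤j : i ≤ j)
                       (s : Step P (vertexAt w i) E (vertexAt w j)) →
                       suc i < j → j ≤ length w → length (shortcut w i≤j s) < length w
    shortcut-shorter (_ ∷ _ ∷ w) (z≤n {suc (suc j)}) _ _        _ = s≤s (s≤s (length-drop-≤ j w))
    shortcut-shorter (_ ∷ _)     (z≤n {suc zero})    _ (s≤s ()) _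
    shortcut-shorter (_ ∷ [])    (z≤n {suc (suc _)}) _ _        (s≤s ())
    shortcut-shorter (_ ∷ w)     (s≤s i≤j)           s (s≤s 1+i<j) (s≤s j≤∣w∣) =
      s≤s (shortcut-shorter w i≤j s 1+i<j j≤∣w∣)

    Shortest : ∀ {x z} → Walk P x z → Set
    Shortest {x} {z} w = ∀ (w′ : Walk P x z) → length w ≤ length w′

    shortest⇒vertices-distinct : ∀ {x z} (w : Walk P x z) → Shortest w →
                                 ∀ {i j : Fin (suc (length w))} → toℕ i < toℕ j →
                                 vertexAt w (toℕ i) ≢ vertexAt w (toℕ j)
    shortest⇒vertices-distinct [] _ {zero} {zero} ()
    shortest⇒vertices-distinct {x} {z} w@(_ ∷ w′) shortest {zero} {suc j} _ x≡wⱼ =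
      <⇒≱ (s≤s (length-drop-≤ (toℕ j) w′)) (from-start x≡wⱼ (drop (toℕ (suc j)) w))
      where
      from-start : ∀ {y} → x ≡ y → (w″ : Walk P y z) → length w ≤ length w″
      from-start refl = shortest
    shortest⇒vertices-distinct w shortest {suc i} {j} i<j wᵢ₊₁≡wⱼ =
      <⇒≱ (shortcut-shorter w i≤j s i<j (toℕ≤pred[n] j)) (shortest (shortcut w i≤j s))
      where
      i≤j : toℕ i ≤ toℕ j
      i≤j = ≤-trans (n≤1+n (toℕ i)) (<⇒≤ i<j)
      s : Step P (vertexAt w (toℕ i)) (edgeAt w i) (vertexAt w (toℕ j))
      s = let (wᵢ∈Eᵢ , wᵢ₊₁∈Eᵢ , Eᵢ-ok) = step-at w i
          in  wᵢ∈Eᵢ , subst (_∈ₕ edgeAt w i) wᵢ₊₁≡wⱼ wᵢ₊₁∈Eᵢ , Eᵢ-ok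

    shortest⇒edges-distinct : ∀ {x z} (w : Walk P x z) → Shortest w →
                              ∀ {i j : Fin (length w)} → toℕ i < toℕ j →
                              ¬ edgeAt w i ≈ₕ edgeAt w j
    shortest⇒edges-distinct w shortest {i} {j} i<j Eᵢ≈Eⱼ =
      <⇒≱ (shortcut-shorter w i≤1+j s (s≤s i<j) (toℕ<n j)) (shortest (shortcut w i≤1+j s))
      where
      i≤1+j : toℕ i ≤ suc (toℕ j)
      i≤1+j = ≤-trans (<⇒≤ i<j) (n≤1+n (toℕ j))
      s : Step P (vertexAt w (toℕ i)) (edgeAt w i) (vertexAt w (suc (toℕ j)))
      s = let (wᵢ∈Eᵢ , _ , Eᵢ-ok) = step-at w i
              (_ , wⱼ₊₁∈Eⱼ , _)   = step-at w j
          in  wᵢ∈Eᵢ , ∈ₕ-resp-≈ₕ Eᵢ≈Eⱼ wⱼ₊₁∈Eⱼ , Eᵢ-ok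

  Avoiding : Hyperedge → Hyperedge → Set
  Avoiding S E = ¬ E ≈ₕ S

  module _ {S : Hyperedge} {x z} (w : Walk (Avoiding S) x z) (shortest : Shortest w)
           (x≢z : x ≢ z) (x∈S : x ∈ₕ S) (z∈S : z ∈ₕ S) where

    -- The cycle  z S x=w₀ E₀ w₁ … E_{m-1} wₘ=z  of the incidence graph.
    close-through : IncidenceCycle 𝒢
    close-through = record
      { k      = suc (length w)
      ; k≥2    = s≤s (x≢z⇒length>0 x≢z w)
      ; u      = u
      ; closed = last≡z
      ; u-inj  = u-inj
      ; col    = proj₁ ∘ E
      ; rep    = proj₂ ∘ E
      ; S-inj  = S-inj
      ; inS    = inS
      ; inS'   = inS′
      }
      where
      u : Fin (suc (suc (length w))) → Fin n
      u zero    = z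
      u (suc i) = vertexAt w (toℕ i)

      E : Fin (suc (length w)) → Hyperedge
      E zero    = S
      E (suc i) = edgeAt w i

      last≡z : vertexAt w (toℕ (fromℕ (length w))) ≡ z
      last≡z = ≡.trans (cong (vertexAt w) (toℕ-fromℕ (length w))) (vertexAt-length w)

      vertices-injective : ∀ {i j} → vertexAt w (toℕ i) ≡ vertexAt w (toℕ j) → i ≡ j
      vertices-injective = symmetric-<-free⇒≡ ≡.sym (shortest⇒vertices-distinct w shortest)

      edges-injective : ∀ {i j} → edgeAt w i ≈ₕ edgeAt w j → i ≡ j
      edges-injective = symmetric-<-free⇒≡ ≈ₕ-sym (shortest⇒edges-distinct w shortest)

      u-inj : ∀ i j → u (inject₁ i) ≡ u (inject₁ j) → i ≡ j
      u-inj zero    zero    _     = refl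
      u-inj zero    (suc j) z≡wⱼ  =
        contradiction (vertices-injective {j = inject₁ j} (≡.trans last≡z z≡wⱼ)) fromℕ≢inject₁
      u-inj (suc i) zero    wᵢ≡z  =
        contradiction (vertices-injective {j = inject₁ i} (≡.trans last≡z (≡.sym wᵢ≡z)))
                      fromℕ≢inject₁
      u-inj (suc i) (suc j) wᵢ≡wⱼ = cong suc (inject₁-injective (vertices-injective wᵢ≡wⱼ))

      S-inj : ∀ i j → E i ≈ₕ E j → i ≡ j
      S-inj zero    zero    _     = refl
      S-inj zero    (suc j) S≈Eⱼ  = contradiction (≈ₕ-sym S≈Eⱼ) (proj₂ (proj₂ (step-at w j)))
      S-inj (suc i) zero    Eᵢ≈S  = contradiction Eᵢ≈S (proj₂ (proj₂ (step-at w i)))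
      S-inj (suc i) (suc j) Eᵢ≈Eⱼ = cong suc (edges-injective Eᵢ≈Eⱼ)

      inS : ∀ i → u (inject₁ i) ∈ₕ E i
      inS zero    = z∈S
      inS (suc i) = subst (λ t → vertexAt w t ∈ₕ edgeAt w i) (≡.sym (toℕ-inject₁ i))
                          (proj₁ (step-at w i))

      inS′ : ∀ i → u (suc i) ∈ₕ E i
      inS′ zero    = x∈S
      inS′ (suc i) = proj₁ (proj₂ (step-at w i))

  no-detour : Acyclic 𝒢 → ∀ {S x z} → x ∈ₕ S → z ∈ₕ S → x ≢ z → ¬ Walk (Avoiding S) x z
  no-detour acyclic x∈S z∈S x≢z w = go w (<-wellFounded (length w))
    where
    go : (w : Walk (Avoiding _) _ _) → Acc _<_ (length w) → ⊥
    go w (acc shorter) =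
      acyclic (close-through w (λ w′ → ≮⇒≥ λ w′<w → go w′ (shorter w′<w)) x≢z x∈S z∈S)

  Linked : Fin n → Fin n → Set
  Linked a b = Σ[ c ∈ Fin q ] b ∈ₕ (c , a)

  Hop : Pred (Fin n) 0ℓ → Fin n → Fin n → Set
  Hop A a b = Linked a b × ¬ A b

  Reachable : Pred (Fin n) 0ℓ → Hyperedge → Fin n → Set
  Reachable A S w = Σ[ a ∈ Fin n ] a ∈ₕ S × ¬ A a × Star (Hop A) a w

  reachable-avoids : ∀ {A S w} → Reachable A S w → ¬ A w
  reachable-avoids (_ , _ , a∉A , p) = end-avoids a∉A p
    where
    end-avoids : ∀ {A a w} → ¬ A a → Star (Hop A) a w → ¬ A w
    end-avoids a∉A ε               = a∉A
    end-avoids _   ((_ , b∉A) ◅ p) = end-avoids b∉A p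

  hops-mono : ∀ {A A′ a b} → (∀ {v} → A′ v → A v) → Star (Hop A) a b → Star (Hop A′) a b
  hops-mono A′⊆A = Star.map (λ (l , b∉A) → l , b∉A ∘ A′⊆A)

  reachable-mono : ∀ {A A′ S w} → (∀ {v} → A′ v → A v) → Reachable A S w → Reachable A′ S w
  reachable-mono A′⊆A (a , a∈S , a∉A , p) = a , a∈S , a∉A ∘ A′⊆A , hops-mono A′⊆A p

  record Exit (A : Pred (Fin n) 0ℓ) (S : Hyperedge) (w : Fin n) : Set where
    field
      {x}    : Fin n
      colour : Fin q
      x∈S    : x ∈ₕ S
      x∉A    : ¬ A x
      beyond : Reachable (_∈ₕ S) (colour , x) w

  stays-outside-or-exits : ∀ {A S a w} → Decidable (_∈ₕ S) → ¬ A a → Star (Hop A) a w →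
                           ¬ w ∈ₕ S → (¬ a ∈ₕ S × Star (Hop (_∈ₕ S)) a w) ⊎ Exit A S w
  stays-outside-or-exits S? a∉A ε w∉S = inj₁ (w∉S , ε)
  stays-outside-or-exits {a = a} S? a∉A (((c , b∈Eₐ) , b∉A) ◅ p) w∉S
    with stays-outside-or-exits S? b∉A p w∉S | S? a
  ... | inj₂ e          | _       = inj₂ e
  ... | inj₁ (b∉S , p′) | yes a∈S =
    inj₂ (record { colour = c ; x∈S = a∈S ; x∉A = a∉A ; beyond = _ , b∈Eₐ , b∉S , p′ })
  ... | inj₁ (b∉S , p′) | no  a∉S = inj₁ (a∉S , ((c , b∈Eₐ) , b∉S) ◅ p′)

  last-exit : ∀ {A S w} → Decidable (_∈ₕ S) → Reachable A S w → ¬ w ∈ₕ S → Exit A S w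
  last-exit S? (a , a∈S , a∉A , p) w∉S with stays-outside-or-exits S? a∉A p w∉S
  ... | inj₁ (a∉S , _) = contradiction a∈S a∉S
  ... | inj₂ e         = e

  module _ (acyclic : Acyclic 𝒢) {S x} (x∈S : x ∈ₕ S) where

    start∉S : ∀ {a} → Walk (Avoiding S) a x → a ≢ x → ¬ a ∈ₕ S
    start∉S wₐ a≢x a∈S = no-detour acyclic a∈S x∈S a≢x wₐ

    -- Each hop leaves a vertex outside S, so through a hyperedge other than S: prepending
    -- it keeps the walk back to x a detour around S.
    stays-outside : ∀ {a v} → Walk (Avoiding S) a x → a ≢ x →
                    Star (Hop (_≡ x)) a v → Star (Hop (_∈ₕ S)) a v
    stays-outside wₐ a≢x ε = ε
    stays-outside {a} wₐ a≢x (_◅_ {j = b} ((c , b∈Eₐ) , b≢x) p) =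
      ((c , b∈Eₐ) , start∉S w_b b≢x) ◅ stays-outside w_b b≢x p
      where
      Eₐ-avoids : Avoiding S (c , a)
      Eₐ-avoids Eₐ≈S = start∉S wₐ a≢x (∈ₕ-resp-≈ₕ (≈ₕ-sym Eₐ≈S) here)
      w_b : Walk (Avoiding S) b x
      w_b = (b∈Eₐ , here , Eₐ-avoids) ∷ wₐ

    confined : ∀ {A c v} → (∀ {u} → A u → u ∈ₕ S) → ¬ A x → Avoiding S (c , x) →
               Reachable (_≡ x) (c , x) v → Reachable A S v
    confined {c = c} A⊆S x∉A Eₓ-avoids (a , a∈Eₓ , a≢x , p) =
      x , x∈S , x∉A , ((c , a∈Eₓ) , start∉S wₐ a≢x ∘ A⊆S) ◅ hops-mono A⊆S (stays-outside wₐ a≢x p)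
      where
      wₐ : Walk (Avoiding S) a x
      wₐ = (a∈Eₓ , here , Eₓ-avoids) ∷ []

module Bound {n q} (G : SimpleGraph n) (𝒢 : Colouring n q) (K : Subset n)
             (colouring : IsColouringOf 𝒢 G) (fully : FullyColoured 𝒢) (acyclic : Acyclic 𝒢)
             (K-max : IsMaxEdge 𝒢 K) (s′ : ℕ) (conn : IsConnector (suc s′) G)
             (∁K-large : s′ + s′ + s′ < ∣ ∁ K ∣) where

  open Incidence 𝒢
  open Connector G s′ conn

  adj⇒linked : ∀ {a b} → Adj G a b → Linked a b
  adj⇒linked {a} {b} e with Equivalence.to (colouring a b) e
  ... | zero  , e₀ = contradiction e₀ (fully a b)
  ... | suc c , eᶜ = c , step eᶜ here

  reachable-step : ∀ {A S a b} → Reachable A S a → ¬ A b → Adj G a b → Reachable A S b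
  reachable-step (a₀ , a₀∈S , a₀∉A , p) b∉A e = a₀ , a₀∈S , a₀∉A , p ◅◅ (adj⇒linked e , b∉A) ◅ ε

  reachable-closedIn : ∀ {A S W} (R? : Decidable (Reachable A S)) → (∀ {b} → b ∈ W → ¬ A b) →
                       ClosedIn W (toSubset R?)
  reachable-closedIn R? W∌A a∈X b∈W e =
    ∈-toSubset⁺ R? (reachable-step (∈-toSubset⁻ R? a∈X) (W∌A b∈W) e)

  ∁-large : ∀ {S} (S? : Decidable (_∈ₕ S)) → s′ + s′ + s′ < ∣ ∁ (toSubset S?) ∣
  ∁-large {c , r} S? = <-≤-trans ∁K-large (∣p∣≤∣q∣⇒∣∁q∣≤∣∁p∣ (toSubset S?) K ∣S∣≤∣K∣)
    where
    ∣S∣≤∣K∣ : ∣ toSubset S? ∣ ≤ ∣ K ∣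
    ∣S∣≤∣K∣ = proj₂ K-max c r _ λ _ → mk⇔ (∈-toSubset⁻ S?) (∈-toSubset⁺ S?)

  module Trapping {S A} (A⊆S : ∀ {v} → A v → v ∈ₕ S) (R? : Decidable (Reachable A S))
                  (smaller-small : ∀ {x c} (R′? : Decidable (Reachable (_≡ x) (c , x))) →
                                   ∣ toSubset R′? ∣ < ∣ toSubset R? ∣ → ∣ toSubset R′? ∣ ≤ s′)
                  (S? : Decidable (_∈ₕ S)) where

    W : Subset n
    W = ∁ (toSubset S?)

    X : Subset n
    X = toSubset R?

    ∈W⇒∉S : ∀ {v} → v ∈ W → ¬ v ∈ₕ S
    ∈W⇒∉S v∈W = x∈∁p⇒x∉p v∈W ∘ ∈-toSubset⁺ S?

    exit-trapped : ∀ {w} → Exit A S w → ¬ ¬ Trapped W w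
    exit-trapped e k = ¬¬-decidable (Reachable (_≡ x) (colour , x)) λ R′? →
      k ( toSubset R′?
        , ∈-toSubset⁺ R′? (reachable-mono (λ { refl → x∈S }) beyond)
        , smaller-small R′? (p⊂q⇒∣p∣<∣q∣ (X′⊂X R′?))
        , reachable-closedIn R′? λ { b∈W refl → ∈W⇒∉S b∈W x∈S })
      where
      open Exit e
      Eₓ-avoids : Avoiding S (colour , x)
      Eₓ-avoids Eₓ≈S = let (_ , y∈Eₓ , y∉S , _) = beyond in y∉S (∈ₕ-resp-≈ₕ (≈ₕ-sym Eₓ≈S) y∈Eₓ)
      X′⊂X : (R′? : Decidable (Reachable (_≡ x) (colour , x))) → toSubset R′? ⊂ X
      X′⊂X R′? =
          (λ v∈X′ → ∈-toSubset⁺ R? (confined acyclic x∈S A⊆S x∉A Eₓ-avoids (∈-toSubset⁻ R′? v∈X′)))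
        , x
        , ∈-toSubset⁺ R? (x , x∈S , x∉A , ε)
        , λ x∈X′ → reachable-avoids (∈-toSubset⁻ R′? x∈X′) refl

    trapped : s′ < ∣ X ∣ → ∀ {w} → w ∈ W → ¬ ¬ Trapped W w
    trapped X-large {w} w∈W k with R? w
    ... | yes w∈X = exit-trapped (last-exit S? w∈X (∈W⇒∉S w∈W)) k
    ... | no  w∉X = k (closedIn-large⇒rest-trapped X-closed X-large w∈W (w∉X ∘ ∈-toSubset⁻ R?))
      where
      X-closed : ClosedIn W X
      X-closed = reachable-closedIn R? λ b∈W → ∈W⇒∉S b∈W ∘ A⊆S

  reachable-small : ∀ S {A} → (∀ {v} → A v → v ∈ₕ S) → (R? : Decidable (Reachable A S)) →
                    ∣ toSubset R? ∣ ≤ s′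
  reachable-small S A⊆S R? = go S A⊆S R? (<-wellFounded _)
    where
    go : ∀ S {A} → (∀ {v} → A v → v ∈ₕ S) → (R? : Decidable (Reachable A S)) →
         Acc _<_ ∣ toSubset R? ∣ → ∣ toSubset R? ∣ ≤ s′
    go S A⊆S R? (acc smaller) = ≮⇒≥ λ X-large → ¬¬-decidable (_∈ₕ S) λ S? →
      ¬-everywhere-trapped (∁-large S?) (Trapping.trapped A⊆S R? smaller-small S? X-large)
      where
      smaller-small : ∀ {x c} (R′? : Decidable (Reachable (_≡ x) (c , x))) →
                      ∣ toSubset R′? ∣ < ∣ toSubset R? ∣ → ∣ toSubset R′? ∣ ≤ s′
      smaller-small R′? ∣X′∣<∣X∣ = go _ (λ { refl → here }) R′? (smaller ∣X′∣<∣X∣)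

  absurd : ⊥
  absurd = ¬-everywhere-trapped {⊤} ∣⊤∣-large trapped
    where
    ∣⊤∣-large : s′ + s′ + s′ < ∣ ⊤ {n} ∣
    ∣⊤∣-large = <-≤-trans ∁K-large (subst (∣ ∁ K ∣ ≤_) (≡.sym (∣⊤∣≡n n)) (∣p∣≤n (∁ K)))
    trapped : ∀ {w} → w ∈ ⊤ → ¬ ¬ Trapped ⊤ w
    trapped {w} _ k = ¬¬-decidable (Reachable (λ _ → ⊥) (proj₁ (proj₁ K-max) , w)) λ R? →
      k ( toSubset R?
        , ∈-toSubset⁺ R? (w , here , (λ ()) , ε)
        , reachable-small _ (λ ()) R?
        , reachable-closedIn R? λ _ ())

∣∁K∣≤3[s∸1] : ∀ {n q s} (G : SimpleGraph n) (𝒢 : Colouring n q) (K : Subset n) →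
              IsConnector s G → IsColouringOf 𝒢 G → FullyColoured 𝒢 → Acyclic 𝒢 →
              IsMaxEdge 𝒢 K → ∣ ∁ K ∣ ≤ 3 * (s ∸ 1)
∣∁K∣≤3[s∸1] {s = zero}   G 𝒢 K conn _         _     _       _     =
  contradiction conn (¬connector-0 G)
∣∁K∣≤3[s∸1] {s = suc s′} G 𝒢 K conn colouring fully acyclic K-max =
  subst (∣ ∁ K ∣ ≤_) s′+s′+s′≡3s′
        (≮⇒≥ (Bound.absurd G 𝒢 K colouring fully acyclic K-max s′ conn))
  where
  s′+s′+s′≡3s′ : s′ + s′ + s′ ≡ 3 * s′
  s′+s′+s′≡3s′ = ≡.trans (+-assoc s′ s′ s′) (cong (λ m → s′ + (s′ + m)) (≡.sym (+-identityʳ s′)))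

lemma3p8 : (n s q : ℕ) (G : SimpleGraph n) (𝒢 : Colouring n q) (K : Subset n) →
    IsConnector s G → IsColouringOf 𝒢 G → FullyColoured 𝒢 → Acyclic 𝒢 →
    IsMaxEdge 𝒢 K →
    ∣ ∁ K ∣ ≤ 13 * (s ∸ 1)
lemma3p8 n s q G 𝒢 K conn colouring fully acyclic K-max =
  ≤-trans (∣∁K∣≤3[s∸1] G 𝒢 K conn colouring fully acyclic K-max)
          (*-monoˡ-≤ (s ∸ 1) {3} {13} (s≤s (s≤s (s≤s z≤n))))
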